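{- Let $B$ be a complement to $\mathfrak{V}$ within $\mathfrak{B}$ and $C$ a complement to $\mathfrak{V}$ within $\mathfrak{C}$. Define $B_W=\{[b]\in B:\ \exists [c]\in C \text{ such that system }(\ast)\text{ is solvable}\}$ and $C_W=\{[c]\in C:\ \exists [b]\in B\text{ such that system }(\ast)\text{ is solvable}\}$, where system $(\ast)$ for $[b],[c]$ asks for $[\gamma_1],[\gamma_2],[\gamma_3]\in J(K)$ with $[\gamma_1]^{1+\sigma_2}=[1]$, $[\gamma_1]^{1+\sigma_1}=[b]$, $[\gamma_2]^{1+\sigma_2}=[b]$, $[\gamma_2]^{1+\sigma_1}=[c]$, $[\gamma_3]^{1+\sigma_2}=[c]$, $[\gamma_3]^{1+\sigma_1}=[1]$. Then $B_W$ and $C_W$ are subspaces, and there exists an $\mathbb{F}_2$-linear bijection $\phi_W:B_W\to C_W$ taking each $[b]\in B_W$ to the unique $[c]\in C_W$ for which $(\ast)$ is solvable for $[b]$ and $[c]$.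
   Context: $F$ is a field with $\operatorname{char}(F)\ne 2$, $K=F(\sqrt{a_1},\sqrt{a_2})$ Galois over $F$ with $G=\operatorname{Gal}(K/F)\simeq\mathbb{Z}/2\oplus\mathbb{Z}/2$, $\sigma_i(\sqrt{a_j})=(-1)^{\delta_{ij}}\sqrt{a_j}$. $J(K)=K^\times/K^{\times2}$, written multiplicatively with exponential $\mathbb{F}_2[G]$-action; $[F^\times]$ is the image of $F^\times$ in $J(K)$. Subspaces of $[F^\times]$: $\mathfrak{B}$ = those $[f]$ with some $[\gamma]\in J(K)$, $[\gamma]^{1+\sigma_2}=[1]$, $[\gamma]^{1+\sigma_1}=[f]$; $\mathfrak{C}$ = those $[f]$ with some $[\gamma]$, $[\gamma]^{1+\sigma_1}=[1]$, $[\gamma]^{1+\sigma_2}=[f]$; $\mathfrak{V}$ = those $[f]$ for which there are $[\gamma_1],[\gamma_2]\in J(K)$ with $[\gamma_1]^{1+\sigma_2}=[1]$, $[\gamma_1]^{1+\sigma_1}=[f]$, $[\gamma_2]^{1+\sigma_2}=[f]$, $[\gamma_2]^{1+\sigma_1}=[1]$. (Thus $\mathfrak{V}\subseteq\mathfrak{B}\cap\mathfrak{C}$.) -}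

module Defs where

open import Level using (Level; _⊔_) renaming (suc to lsuc)
open import Algebra.Bundles using (CommutativeRing)
open import Algebra.Morphism.Structures using (module RingMorphisms)
open import Data.Product using (Σ; ∃; ∃-syntax; _×_; _,_; proj₁; proj₂)
open import Relation.Nullary using (¬_)

record Field (c ℓ : Level) : Set (lsuc (c ⊔ ℓ)) where
  field
    commutativeRing : CommutativeRing c ℓ
  open CommutativeRing commutativeRing public
  field
    1≉0     : ¬ (1# ≈ 0#)
    inverse : ∀ x → ¬ (x ≈ 0#) → ∃ λ y → x * y ≈ 1#

-- F is given abstractly, with a field embedding ι : F → K (over which K
-- is regarded as an extension of F).

record Biquadratic (c ℓ : Level) : Set (lsuc (c ⊔ ℓ)) where
  field
    F K : Field c ℓ
  module F = Field F
  module K = Field K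
  open RingMorphisms F.rawRing K.rawRing using (IsRingHomomorphism)
  open RingMorphisms K.rawRing K.rawRing using (IsRingIsomorphism)
  field
    char≢2 : ¬ (F._+_ F.1# F.1# F.≈ F.0#)
    ι      : F.Carrier → K.Carrier
    ι-hom  : IsRingHomomorphism ι
    a₁ a₂  : F.Carrier
    α₁ α₂  : K.Carrier
    α₁²    : α₁ K.* α₁ K.≈ ι a₁
    α₂²    : α₂ K.* α₂ K.≈ ι a₂
    -- [K : F] = 4, i.e. G ≃ ℤ/2 ⊕ ℤ/2: a₁, a₂, a₁a₂ are non-squares in F
    a₁-nonsq   : ¬ (∃ λ x → x F.* x F.≈ a₁)
    a₂-nonsq   : ¬ (∃ λ x → x F.* x F.≈ a₂)
    a₁a₂-nonsq : ¬ (∃ λ x → x F.* x F.≈ (a₁ F.* a₂))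
    generated : ∀ x → ∃ λ (cs : F.Carrier × F.Carrier × F.Carrier × F.Carrier) →
      let (c₀ , c₁ , c₂ , c₃) = cs in
      x K.≈ (ι c₀ K.+ ι c₁ K.* α₁) K.+ (ι c₂ K.* α₂ K.+ ι c₃ K.* (α₁ K.* α₂))
    σ₁ σ₂  : K.Carrier → K.Carrier
    σ₁-iso : IsRingIsomorphism σ₁
    σ₂-iso : IsRingIsomorphism σ₂
    σ₁-fix : ∀ f → σ₁ (ι f) K.≈ ι f
    σ₂-fix : ∀ f → σ₂ (ι f) K.≈ ι f
    σ₁α₁   : σ₁ α₁ K.≈ K.- α₁
    σ₁α₂   : σ₁ α₂ K.≈ α₂
    σ₂α₁   : σ₂ α₁ K.≈ α₁
    σ₂α₂   : σ₂ α₂ K.≈ K.- α₂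

-- J(K) = K^× / K^{×2}.  An element [x] of J(K) is represented by a
-- nonzero x ∈ K; [x] = [y] iff x = y z² for some nonzero z.  Subsets of
-- J(K) are predicates on K (required to consist of nonzero elements and
-- to respect square classes).

module Theory {c ℓ : Level} (S : Biquadratic c ℓ) where
  open Biquadratic S

  Pred : Set (lsuc (c ⊔ ℓ))
  Pred = K.Carrier → Set (c ⊔ ℓ)

  Nonzero : K.Carrier → Set ℓ
  Nonzero x = ¬ (x K.≈ K.0#)

  _∼_ : K.Carrier → K.Carrier → Set (c ⊔ ℓ)
  x ∼ y = ∃ λ z → Nonzero z × (x K.≈ y K.* (z K.* z))

  -- [γ]^{1+σ} = [γ · σ(γ)]
  N₁ N₂ : K.Carrier → K.Carrier
  N₁ γ = γ K.* σ₁ γ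
  N₂ γ = γ K.* σ₂ γ

  [F×] : Pred
  [F×] x = Nonzero x × ∃ λ f → x ∼ ι f

  𝔅 : Pred
  𝔅 f = [F×] f × ∃ λ γ → Nonzero γ × (N₂ γ ∼ K.1#) × (N₁ γ ∼ f)

  ℭ : Pred
  ℭ f = [F×] f × ∃ λ γ → Nonzero γ × (N₁ γ ∼ K.1#) × (N₂ γ ∼ f)

  𝔙 : Pred
  𝔙 f = [F×] f
      × (∃ λ γ₁ → Nonzero γ₁ × (N₂ γ₁ ∼ K.1#) × (N₁ γ₁ ∼ f))
      × (∃ λ γ₂ → Nonzero γ₂ × (N₂ γ₂ ∼ f) × (N₁ γ₂ ∼ K.1#))

  -- P is an 𝔽₂-subspace of J(K) (J(K) is written multiplicatively, so a
  -- subspace is a subgroup; every element is its own inverse).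
  record IsSubspace (P : Pred) : Set (c ⊔ ℓ) where
    field
      nonzero : ∀ {x} → P x → Nonzero x
      resp    : ∀ {x y} → x ∼ y → P x → P y
      one     : P K.1#
      mul     : ∀ {x y} → P x → P y → P (x K.* y)

  record IsComplement (A V W : Pred) : Set (c ⊔ ℓ) where
    field
      subspace : IsSubspace A
      A⊆W      : ∀ {x} → A x → W x
      A∩V      : ∀ {x} → A x → V x → x ∼ K.1#
      A·V      : ∀ {w} → W w → ∃ λ a → ∃ λ v → A a × V v × (w ∼ (a K.* v))

  System : K.Carrier → K.Carrier → Set (c ⊔ ℓ)
  System b c = ∃ λ γ₁ → ∃ λ γ₂ → ∃ λ γ₃ →
      Nonzero γ₁ × Nonzero γ₂ × Nonzero γ₃
    × (N₂ γ₁ ∼ K.1#) × (N₁ γ₁ ∼ b)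
    × (N₂ γ₂ ∼ b)    × (N₁ γ₂ ∼ c)
    × (N₂ γ₃ ∼ c)    × (N₁ γ₃ ∼ K.1#)

  BW : (B C : Pred) → Pred
  BW B C b = B b × ∃ λ c → C c × System b c

  CW : (B C : Pred) → Pred
  CW B C c = C c × ∃ λ b → B b × System b c

  -- Elements of B_W are
  -- pairs (b , proof); linearity is multiplicativity on J(K).
  record IsPhiW (B C : Pred) (φ : Σ K.Carrier (BW B C) → K.Carrier) : Set (c ⊔ ℓ) where
    field
      into     : ∀ p → CW B C (φ p)
      solves   : ∀ p → System (proj₁ p) (φ p)
      unique   : ∀ p c → CW B C c → System (proj₁ p) c → c ∼ φ p
      wellDef  : ∀ p q → proj₁ p ∼ proj₁ q → φ p ∼ φ q
      linear   : ∀ p q r → proj₁ r ∼ (proj₁ p K.* proj₁ q) → φ r ∼ (φ p K.* φ q)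
      injective  : ∀ p q → φ p ∼ φ q → proj₁ p ∼ proj₁ q
      surjective : ∀ c → CW B C c → ∃ λ p → φ p ∼ c

{-# OPTIONS --safe #-}
module Submission where

open import Defs
open import Level using (_⊔_)
open import Data.Product using (Σ; _×_; _,_; proj₁)
open import Relation.Nullary using (¬_)
open import Algebra.Morphism.Structures using (module RingMorphisms)
import Algebra.Properties.CommutativeSemigroup as CommutativeSemigroupProperties
import Relation.Binary.Reasoning.Setoid as SetoidReasoning

-- The pairs ([b],[c]) for which (∗) is solvable form a subgroup of J(K) × J(K),
-- because γ ↦ γ σᵢ(γ) is multiplicative.  If (∗) holds for ([b],[c]) and
-- ([b],[c']), it therefore holds for ([1],[c c']), which puts [c c'] in 𝔙;
-- as [c c'] also lies in the complement C, it is trivial and [c] = [c'].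
-- Symmetrically [c] determines [b], so [b] ↦ [c] is a well-defined linear
-- bijection B_W → C_W.

module SquareClasses {c ℓ} (K : Field c ℓ) where
  open Field K
  open CommutativeSemigroupProperties *-commutativeSemigroup using (interchange)
  open SetoidReasoning setoid

  Nonzero : Carrier → Set ℓ
  Nonzero x = ¬ (x ≈ 0#)

  infix 4 _∼_
  _∼_ : Carrier → Carrier → Set (c ⊔ ℓ)
  x ∼ y = Σ Carrier λ z → Nonzero z × (x ≈ y * (z * z))

  *-nonzero : ∀ {x y} → Nonzero x → Nonzero y → Nonzero (x * y)
  *-nonzero {x} {y} x≉0 y≉0 xy≈0 with inverse x x≉0
  ... | u , xu≈1 = y≉0 (begin
    y            ≈⟨ sym (*-identityˡ y) ⟩
    1# * y       ≈⟨ *-congʳ (sym xu≈1) ⟩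
    (x * u) * y  ≈⟨ *-congʳ (*-comm x u) ⟩
    (u * x) * y  ≈⟨ *-assoc u x y ⟩
    u * (x * y)  ≈⟨ *-congˡ xy≈0 ⟩
    u * 0#       ≈⟨ zeroʳ u ⟩
    0#           ∎)

  inverse-nonzero : ∀ {x y} → x * y ≈ 1# → Nonzero y
  inverse-nonzero {x} {y} xy≈1 y≈0 = 1≉0 (begin
    1#      ≈⟨ sym xy≈1 ⟩
    x * y   ≈⟨ *-congˡ y≈0 ⟩
    x * 0#  ≈⟨ zeroʳ x ⟩
    0#      ∎)

  ≈⇒∼ : ∀ {x y} → x ≈ y → x ∼ y
  ≈⇒∼ {x} {y} x≈y = 1# , 1≉0 , (begin
    x              ≈⟨ x≈y ⟩
    y              ≈⟨ sym (*-identityʳ y) ⟩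
    y * 1#         ≈⟨ *-congˡ (sym (*-identityˡ 1#)) ⟩
    y * (1# * 1#)  ∎)

  ∼-refl : ∀ {x} → x ∼ x
  ∼-refl = ≈⇒∼ refl

  ∼-sym : ∀ {x y} → x ∼ y → y ∼ x
  ∼-sym {x} {y} (u , u≉0 , x≈yuu) with inverse u u≉0
  ... | w , uw≈1 = w , inverse-nonzero uw≈1 , (begin
    y                        ≈⟨ sym (*-identityʳ y) ⟩
    y * 1#                   ≈⟨ *-congˡ (sym (*-identityˡ 1#)) ⟩
    y * (1# * 1#)            ≈⟨ *-congˡ (*-cong (sym uw≈1) (sym uw≈1)) ⟩
    y * ((u * w) * (u * w))  ≈⟨ *-congˡ (interchange u w u w) ⟩
    y * ((u * u) * (w * w))  ≈⟨ sym (*-assoc y (u * u) (w * w)) ⟩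
    (y * (u * u)) * (w * w)  ≈⟨ *-congʳ (sym x≈yuu) ⟩
    x * (w * w)              ∎)

  ∼-trans : ∀ {x y z} → x ∼ y → y ∼ z → x ∼ z
  ∼-trans {x} {y} {z} (u , u≉0 , x≈yuu) (v , v≉0 , y≈zvv) = v * u , *-nonzero v≉0 u≉0 , (begin
    x                        ≈⟨ x≈yuu ⟩
    y * (u * u)              ≈⟨ *-congʳ y≈zvv ⟩
    (z * (v * v)) * (u * u)  ≈⟨ *-assoc z (v * v) (u * u) ⟩
    z * ((v * v) * (u * u))  ≈⟨ *-congˡ (interchange v v u u) ⟩
    z * ((v * u) * (v * u))  ∎)

  *-cong-∼ : ∀ {x y x′ y′} → x ∼ y → x′ ∼ y′ → x * x′ ∼ y * y′
  *-cong-∼ {x} {y} {x′} {y′} (u , u≉0 , x≈yuu) (v , v≉0 , x′≈y′vv) = u * v , *-nonzero u≉0 v≉0 , (begin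
    x * x′                          ≈⟨ *-cong x≈yuu x′≈y′vv ⟩
    (y * (u * u)) * (y′ * (v * v))  ≈⟨ interchange y (u * u) y′ (v * v) ⟩
    (y * y′) * ((u * u) * (v * v))  ≈⟨ *-congˡ (interchange u u v v) ⟩
    (y * y′) * ((u * v) * (u * v))  ∎)

  *-∼1 : ∀ {x y} → x ∼ 1# → y ∼ 1# → x * y ∼ 1#
  *-∼1 x∼1 y∼1 = ∼-trans (*-cong-∼ x∼1 y∼1) (≈⇒∼ (*-identityˡ 1#))

  square∼1 : ∀ {x} → Nonzero x → x * x ∼ 1#
  square∼1 {x} x≉0 = x , x≉0 , sym (*-identityˡ (x * x))

  -- In J(K) every element is its own inverse.
  *∼1⇒∼ : ∀ {x y} → Nonzero y → x * y ∼ 1# → x ∼ y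
  *∼1⇒∼ {x} {y} y≉0 xy∼1 =
    ∼-trans (≈⇒∼ (sym (*-identityʳ x)))
    (∼-trans (*-cong-∼ (∼-refl {x}) (∼-sym (square∼1 y≉0)))
    (∼-trans (≈⇒∼ (sym (*-assoc x y y)))
    (∼-trans (*-cong-∼ xy∼1 (∼-refl {y}))
             (≈⇒∼ (*-identityˡ y)))))

  module Norm {σ : Carrier → Carrier}
              (σ-hom : RingMorphisms.IsRingHomomorphism rawRing rawRing σ) where
    open RingMorphisms.IsRingHomomorphism σ-hom using (*-homo; 1#-homo)

    norm : Carrier → Carrier
    norm x = x * σ x

    norm-* : ∀ x y → norm (x * y) ≈ norm x * norm y
    norm-* x y = trans (*-congˡ (*-homo x y)) (interchange x y (σ x) (σ y))

    norm-1 : norm 1# ≈ 1#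
    norm-1 = trans (*-congˡ 1#-homo) (*-identityˡ 1#)

    norm-*-∼ : ∀ {x y a b} → norm x ∼ a → norm y ∼ b → norm (x * y) ∼ a * b
    norm-*-∼ {x} {y} nx∼a ny∼b = ∼-trans (≈⇒∼ (norm-* x y)) (*-cong-∼ nx∼a ny∼b)

    norm-*-∼1 : ∀ {x y} → norm x ∼ 1# → norm y ∼ 1# → norm (x * y) ∼ 1#
    norm-*-∼1 {x} {y} nx∼1 ny∼1 = ∼-trans (≈⇒∼ (norm-* x y)) (*-∼1 nx∼1 ny∼1)

module Solvability {c ℓ} (S : Biquadratic c ℓ) where
  open Biquadratic S
  open Theory S
  open SquareClasses K hiding (Nonzero; _∼_)
  open K using (_*_; 1#)
  open RingMorphisms.IsRingIsomorphism using (isRingHomomorphism)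
  module N₁ = Norm (isRingHomomorphism σ₁-iso)
  module N₂ = Norm (isRingHomomorphism σ₂-iso)

  System-1 : System 1# 1#
  System-1 = 1# , 1# , 1# , K.1≉0 , K.1≉0 , K.1≉0
           , ≈⇒∼ N₂.norm-1 , ≈⇒∼ N₁.norm-1 , ≈⇒∼ N₂.norm-1
           , ≈⇒∼ N₁.norm-1 , ≈⇒∼ N₂.norm-1 , ≈⇒∼ N₁.norm-1

  System-* : ∀ {b c b′ c′} → System b c → System b′ c′ → System (b * b′) (c * c′)
  System-* (γ₁ , γ₂ , γ₃ , n₁ , n₂ , n₃ , e₁ , e₂ , e₃ , e₄ , e₅ , e₆)
           (δ₁ , δ₂ , δ₃ , m₁ , m₂ , m₃ , f₁ , f₂ , f₃ , f₄ , f₅ , f₆) =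
    γ₁ * δ₁ , γ₂ * δ₂ , γ₃ * δ₃ , *-nonzero n₁ m₁ , *-nonzero n₂ m₂ , *-nonzero n₃ m₃ ,
    N₂.norm-*-∼1 e₁ f₁ , N₁.norm-*-∼ e₂ f₂ , N₂.norm-*-∼ e₃ f₃ ,
    N₁.norm-*-∼ e₄ f₄ , N₂.norm-*-∼ e₅ f₅ , N₁.norm-*-∼1 e₆ f₆

  System-resp : ∀ {b c b′ c′} → b ∼ b′ → c ∼ c′ → System b c → System b′ c′
  System-resp b∼b′ c∼c′ (γ₁ , γ₂ , γ₃ , n₁ , n₂ , n₃ , e₁ , e₂ , e₃ , e₄ , e₅ , e₆) =
    γ₁ , γ₂ , γ₃ , n₁ , n₂ , n₃ ,
    e₁ , ∼-trans e₂ b∼b′ , ∼-trans e₃ b∼b′ , ∼-trans e₄ c∼c′ , ∼-trans e₅ c∼c′ , e₆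

  System-1ˡ⇒𝔙 : ∀ {b c} → [F×] c → b ∼ 1# → System b c → 𝔙 c
  System-1ˡ⇒𝔙 c∈F× b∼1 (_ , γ₂ , γ₃ , _ , n₂ , n₃ , _ , _ , e₃ , e₄ , e₅ , e₆) =
    c∈F× , (γ₂ , n₂ , ∼-trans e₃ b∼1 , e₄) , (γ₃ , n₃ , e₅ , e₆)

  System-1ʳ⇒𝔙 : ∀ {b c} → [F×] b → c ∼ 1# → System b c → 𝔙 b
  System-1ʳ⇒𝔙 b∈F× c∼1 (γ₁ , γ₂ , _ , n₁ , n₂ , _ , e₁ , e₂ , e₃ , e₄ , _ , _) =
    b∈F× , (γ₁ , n₁ , e₁ , e₂) , (γ₂ , n₂ , e₃ , ∼-trans e₄ c∼1)

  complement-∼ : ∀ {A W} → IsComplement A 𝔙 W →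
                 ∀ {x y} → A x → A y → 𝔙 (x * y) → x ∼ y
  complement-∼ hA x∈A y∈A xy∈𝔙 =
    *∼1⇒∼ (nonzero y∈A) (A∩V (mul x∈A y∈A) xy∈𝔙)
    where open IsComplement hA
          open IsSubspace subspace

  module Complements (B C : Pred) (hB : IsComplement B 𝔙 𝔅) (hC : IsComplement C 𝔙 ℭ) where
    module B = IsSubspace (IsComplement.subspace hB)
    module C = IsSubspace (IsComplement.subspace hC)

    System-unique-c : ∀ {b c c′} → B b → C c → C c′ → System b c → System b c′ → c ∼ c′
    System-unique-c b∈B c∈C c′∈C s s′ =
      complement-∼ hC c∈C c′∈C
        (System-1ˡ⇒𝔙 (proj₁ (IsComplement.A⊆W hC (C.mul c∈C c′∈C)))
                     (square∼1 (B.nonzero b∈B)) (System-* s s′))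

    System-unique-b : ∀ {b b′ c} → B b → B b′ → C c → System b c → System b′ c → b ∼ b′
    System-unique-b b∈B b′∈B c∈C s s′ =
      complement-∼ hB b∈B b′∈B
        (System-1ʳ⇒𝔙 (proj₁ (IsComplement.A⊆W hB (B.mul b∈B b′∈B)))
                     (square∼1 (C.nonzero c∈C)) (System-* s s′))

    BW-subspace : IsSubspace (BW B C)
    BW-subspace = record
      { nonzero = λ (b∈B , _) → B.nonzero b∈B
      ; resp    = λ { x∼y (x∈B , c , c∈C , s) → B.resp x∼y x∈B , c , c∈C , System-resp x∼y ∼-refl s }
      ; one     = B.one , 1# , C.one , System-1
      ; mul     = λ { (x∈B , c , c∈C , s) (y∈B , c′ , c′∈C , s′) →
                      B.mul x∈B y∈B , c * c′ , C.mul c∈C c′∈C , System-* s s′ }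
      }

    CW-subspace : IsSubspace (CW B C)
    CW-subspace = record
      { nonzero = λ (c∈C , _) → C.nonzero c∈C
      ; resp    = λ { x∼y (x∈C , b , b∈B , s) → C.resp x∼y x∈C , b , b∈B , System-resp ∼-refl x∼y s }
      ; one     = C.one , 1# , B.one , System-1
      ; mul     = λ { (x∈C , b , b∈B , s) (y∈C , b′ , b′∈B , s′) →
                      C.mul x∈C y∈C , b * b′ , B.mul b∈B b′∈B , System-* s s′ }
      }

    φW : Σ K.Carrier (BW B C) → K.Carrier
    φW (_ , _ , c , _) = c

    φW-isPhiW : IsPhiW B C φW
    φW-isPhiW = record
      { into       = λ { (b , b∈B , c , c∈C , s) → c∈C , b , b∈B , s }
      ; solves     = λ { (_ , _ , _ , _ , s) → s }
      ; unique     = λ { (_ , b∈B , _ , c∈C , s) _ (c′∈C , _) s′ →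
                           System-unique-c b∈B c′∈C c∈C s′ s }
      ; wellDef    = λ { (_ , b∈B , _ , c∈C , s) (_ , _ , _ , c′∈C , s′) b∼b′ →
                           System-unique-c b∈B c∈C c′∈C s (System-resp (∼-sym b∼b′) ∼-refl s′) }
      ; linear     = λ { (_ , _ , _ , c∈C , s) (_ , _ , _ , c′∈C , s′) (_ , b″∈B , _ , c″∈C , s″) b″∼bb′ →
                           System-unique-c b″∈B c″∈C (C.mul c∈C c′∈C) s″
                             (System-resp (∼-sym b″∼bb′) ∼-refl (System-* s s′)) }
      ; injective  = λ { (_ , b∈B , _ , c∈C , s) (_ , b′∈B , _ , _ , s′) c∼c′ →
                           System-unique-b b∈B b′∈B c∈C s (System-resp ∼-refl (∼-sym c∼c′) s′) }
      ; surjective = λ { c (c∈C , b , b∈B , s) → (b , b∈B , c , c∈C , s) , ∼-refl }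
      }

lemma3p2 : ∀ {c ℓ} (S : Biquadratic c ℓ) (B C : Theory.Pred S) →
    Theory.IsComplement S B (Theory.𝔙 S) (Theory.𝔅 S) →
    Theory.IsComplement S C (Theory.𝔙 S) (Theory.ℭ S) →
    Theory.IsSubspace S (Theory.BW S B C)
    × Theory.IsSubspace S (Theory.CW S B C)
    × Σ _ (Theory.IsPhiW S B C)
lemma3p2 S B C hB hC = BW-subspace , CW-subspace , φW , φW-isPhiW
  where open Solvability.Complements S B C hB hC
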